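{- Let $\mathbb{M}_{2,\mathrm{Mersenne}}=\{m : m=2^t-1=pq \text{ where } t,p,q \text{ are primes}\}$. (a) Any two distinct elements of $\mathbb{M}_{2,\mathrm{Mersenne}}$ are relatively prime. (b) Every element of $\mathbb{M}_{2,\mathrm{Mersenne}}$ is relatively prime to $511$. -}

module Defs where

open import Data.Nat using (ℕ; _^_; _∸_; _*_)
open import Data.Nat.Primality using (Prime)
open import Data.Product using (∃-syntax; _×_)
open import Relation.Binary.PropositionalEquality using (_≡_)

-- m ∈ 𝕄_{2,Mersenne}  iff  m = 2^t - 1 = p * q  with t, p, q prime.
-- (2^t ≥ 1, so truncated subtraction is exact here.)
M2Mersenne : ℕ → Set
M2Mersenne m = ∃[ t ] ∃[ p ] ∃[ q ]
  (Prime t × Prime p × Prime q × m ≡ 2 ^ t ∸ 1 × m ≡ p * q)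

module Submission where

-- Fix a base a ≥ 1 and a number d, and call an exponent k
-- "annihilating" when d ∣ aᵏ − 1.  From the identity
--   a^(x+y) − 1 = (aˣ − 1)·aʸ + (aʸ − 1)
-- the annihilating exponents contain 0 and are closed under addition and
-- under cancellation (x and x + y annihilating ⇒ y annihilating).  Any such
-- set of naturals that contains two coprime numbers m, n contains 1, by
-- Bézout's identity 1 + y·n = x·m.  Hence a common divisor of aᵐ − 1 and
-- aⁿ − 1 divides a − 1, which for a = 2 gives Coprime (2ᵐ − 1) (2ⁿ − 1).
--
-- (a) Distinct elements 2ᵗ − 1 ≠ 2ˢ − 1 have distinct prime exponents,
--     which are coprime.
-- (b) 511 = 2⁹ − 1, and a prime t is coprime to 9 unless t = 3; but
--     2³ − 1 = 7 is prime, hence not a product of two primes.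

open import Defs
open import Data.Nat using (ℕ)
open import Data.Nat.Coprimality using (Coprime)
open import Data.Product using (_×_)
open import Relation.Binary.PropositionalEquality using (_≢_)

open import Data.Nat using (zero; suc; _+_; _*_; _∸_; _^_; NonZero; nonTrivial⇒≢1)
open import Data.Nat.Properties using (m^n>0; ^-distribˡ-+-*; +-comm; +-suc; *-comm; *-identityʳ; *-cancelˡ-≡; suc-injective)
open import Data.Nat.Divisibility using (_∣_; divides; ∣m⇒∣m*n; ∣m∣n⇒∣m+n; ∣m+n∣m⇒∣n; ∣1⇒≡1; _∣0)
open import Data.Nat.Primality using (Prime; prime; prime?; prime⇒nonZero; prime⇒irreducible; euclidsLemma)
open import Data.Nat.Coprimality using (coprime-Bézout)
open import Data.Nat.GCD using (module Bézout)
open import Data.Product using (_,_)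
open import Data.Sum using (inj₁; inj₂)
open import Data.Unit using (tt)
open import Relation.Binary.PropositionalEquality using (_≡_; refl; sym; trans; cong; subst; module ≡-Reasoning)
open import Relation.Nullary using (¬_; contradiction)
open import Relation.Nullary.Decidable using (toWitness)

module BézoutClosure
  (P : ℕ → Set)
  (P-zero : P 0)
  (P-+ : ∀ {x y} → P x → P y → P (x + y))
  (P-cancel : ∀ {x y} → P x → P (x + y) → P y)
  where

  P-multiple : ∀ k {x} → P x → P (k * x)
  P-multiple zero    px = P-zero
  P-multiple (suc k) px = P-+ px (P-multiple k px)

  P-one-from : ∀ {u v} → P u → P v → 1 + u ≡ v → P 1
  P-one-from {u} pu pv 1+u≡v = P-cancel pu (subst P (sym (trans (+-comm u 1) 1+u≡v)) pv)

  -- Bézout gives 1 + y·n = x·m (or the symmetric identity), both sides in P.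
  P-one : ∀ {m n} → Coprime m n → P m → P n → P 1
  P-one m⊥n pm pn with coprime-Bézout m⊥n
  ... | Bézout.+- x y eq = P-one-from (P-multiple y pn) (P-multiple x pm) eq
  ... | Bézout.-+ x y eq = P-one-from (P-multiple x pm) (P-multiple y pn) eq

module PowerMinusOne (a : ℕ) .{{a≢0 : NonZero a}} where

  pow≡suc : ∀ k → a ^ k ≡ suc (a ^ k ∸ 1)
  pow≡suc k with a ^ k | m^n>0 a k
  ... | suc _ | _ = refl

  pow-+-∸1 : ∀ x y → a ^ (x + y) ∸ 1 ≡ (a ^ x ∸ 1) * a ^ y + (a ^ y ∸ 1)
  pow-+-∸1 x y = suc-injective (begin
      suc (a ^ (x + y) ∸ 1)              ≡⟨ sym (pow≡suc (x + y)) ⟩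
      a ^ (x + y)                        ≡⟨ ^-distribˡ-+-* a x y ⟩
      a ^ x * a ^ y                      ≡⟨ cong (_* a ^ y) (pow≡suc x) ⟩
      a ^ y + (a ^ x ∸ 1) * a ^ y        ≡⟨ +-comm (a ^ y) _ ⟩
      (a ^ x ∸ 1) * a ^ y + a ^ y        ≡⟨ cong ((a ^ x ∸ 1) * a ^ y +_) (pow≡suc y) ⟩
      (a ^ x ∸ 1) * a ^ y + suc (a ^ y ∸ 1) ≡⟨ +-suc _ _ ⟩
      suc ((a ^ x ∸ 1) * a ^ y + (a ^ y ∸ 1)) ∎)
    where open ≡-Reasoning

  Annihilating : ℕ → ℕ → Set
  Annihilating d k = d ∣ a ^ k ∸ 1

  annihilating-+ : ∀ {d x y} → Annihilating d x → Annihilating d y → Annihilating d (x + y)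
  annihilating-+ {d} {x} {y} dx dy =
    subst (d ∣_) (sym (pow-+-∸1 x y)) (∣m∣n⇒∣m+n (∣m⇒∣m*n (a ^ y) dx) dy)

  annihilating-cancel : ∀ {d x y} → Annihilating d x → Annihilating d (x + y) → Annihilating d y
  annihilating-cancel {d} {x} {y} dx dxy =
    ∣m+n∣m⇒∣n (subst (d ∣_) (pow-+-∸1 x y) dxy) (∣m⇒∣m*n (a ^ y) dx)

  common-divisor∣a∸1 : ∀ {d m n} → Coprime m n →
    d ∣ a ^ m ∸ 1 → d ∣ a ^ n ∸ 1 → d ∣ a ^ 1 ∸ 1
  common-divisor∣a∸1 {d} = P-one
    where open BézoutClosure (Annihilating d) (d ∣0)
                 (λ {x} {y} → annihilating-+ {d} {x} {y})
                 (λ {x} {y} → annihilating-cancel {d} {x} {y})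

mersenne-coprime : ∀ {m n} → Coprime m n → Coprime (2 ^ m ∸ 1) (2 ^ n ∸ 1)
mersenne-coprime m⊥n (d∣Mm , d∣Mn) = ∣1⇒≡1 (common-divisor∣a∸1 m⊥n d∣Mm d∣Mn)
  where open PowerMinusOne 2

prime≢1 : ∀ {p} → Prime p → p ≢ 1
prime≢1 (prime _) = nonTrivial⇒≢1

prime∣prime⇒≡ : ∀ {p q} → Prime p → Prime q → p ∣ q → p ≡ q
prime∣prime⇒≡ pp pq p∣q with prime⇒irreducible pq p∣q
... | inj₁ p≡1 = contradiction p≡1 (prime≢1 pp)
... | inj₂ p≡q = p≡q

prime∤⇒coprime : ∀ {p n} → Prime p → ¬ p ∣ n → Coprime p n
prime∤⇒coprime pp p∤n (d∣p , d∣n) with prime⇒irreducible pp d∣p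
... | inj₁ d≡1  = d≡1
... | inj₂ refl = contradiction d∣n p∤n

prime≢prime*prime : ∀ {r p q} → Prime r → Prime p → Prime q → r ≢ p * q
prime≢prime*prime {r} {p} {q} pr pp pq r≡pq
  with prime∣prime⇒≡ pp pr (divides q (trans r≡pq (*-comm p q)))
... | refl = prime≢1 pq (sym (*-cancelˡ-≡ 1 q r {{prime⇒nonZero pr}} (trans (*-identityʳ r) r≡pq)))

prime[3] : Prime 3
prime[3] = toWitness {a? = prime? 3} tt

prime[7] : Prime 7
prime[7] = toWitness {a? = prime? 7} tt

prime∣9⇒≡3 : ∀ {t} → Prime t → t ∣ 9 → t ≡ 3
prime∣9⇒≡3 pt t∣9 with euclidsLemma 3 3 pt t∣9
... | inj₁ t∣3 = prime∣prime⇒≡ pt prime[3] t∣3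
... | inj₂ t∣3 = prime∣prime⇒≡ pt prime[3] t∣3

proposition3p7 : (∀ m n → M2Mersenne m → M2Mersenne n → m ≢ n → Coprime m n)
    × (∀ m → M2Mersenne m → Coprime m 511)
proposition3p7 = distinct-coprime , coprime-511
  where
  distinct-coprime : ∀ m n → M2Mersenne m → M2Mersenne n → m ≢ n → Coprime m n
  distinct-coprime _ _ (t , _ , _ , pt , _ , _ , refl , _) (s , _ , _ , ps , _ , _ , refl , _) m≢n =
    mersenne-coprime (prime∤⇒coprime pt (λ t∣s → m≢n (cong (λ k → 2 ^ k ∸ 1) (prime∣prime⇒≡ pt ps t∣s))))

  -- 511 = 2⁹ − 1; the exponent t = 3 is excluded since 2³ − 1 = 7 is prime.
  coprime-511 : ∀ m → M2Mersenne m → Coprime m 511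
  coprime-511 _ (t , p , q , pt , pp , pq , refl , m≡pq) =
    mersenne-coprime {t} {9} (prime∤⇒coprime pt t∤9)
    where
    t∤9 : ¬ t ∣ 9
    t∤9 t∣9 with prime∣9⇒≡3 pt t∣9
    ... | refl = prime≢prime*prime prime[7] pp pq m≡pq
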